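{- For any integers $a,b$ with $a\ge b\ge 2$, there exists a finite simple graph $G_{a,b}$ with $\delta(G_{a,b})=b$, $\Delta(G_{a,b})=a+1$ and $\chi_2(G_{a,b})-\chi(G_{a,b})=\left\lceil \frac{\Delta(G_{a,b})}{\delta(G_{a,b})}\right\rceil$.
   Context: $\delta$ and $\Delta$ denote minimum and maximum degree, $\chi$ the chromatic number. A dynamic coloring of $G$ is a proper vertex coloring such that for every vertex $v$ of degree at least $2$, the neighbours of $v$ receive at least two different colors; $\chi_2(G)$ is the smallest number of colors in a dynamic coloring of $G$. -}

module Defs where

open import Data.Nat using (ℕ; zero; suc; _+_; _∸_; _≤_; NonZero)
open import Data.Nat.DivMod using (_/_)
open import Data.Bool using (Bool; true; false)
open import Data.Fin using (Fin)
open import Data.List using (List; length; filter)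
open import Data.List.Base using (allFin)
open import Data.Product using (Σ; ∃; _×_; _,_)
open import Relation.Binary.PropositionalEquality using (_≡_; _≢_)
open import Relation.Nullary using (¬_)
open import Data.Bool.Properties using (T?)
open import Data.Bool using (T)

record Graph (n : ℕ) : Set where
  field
    adj   : Fin n → Fin n → Bool
    sym   : ∀ u v → adj u v ≡ adj v u
    loopless : ∀ v → adj v v ≡ false

open Graph public

Adj : ∀ {n} → Graph n → Fin n → Fin n → Set
Adj G u v = T (adj G u v)

deg : ∀ {n} → Graph n → Fin n → ℕ
deg {n} G v = length (filter (λ u → T? (adj G v u)) (allFin n))

IsMinDeg : ∀ {n} → Graph n → ℕ → Set
IsMinDeg {n} G d = (∃ λ (v : Fin n) → deg G v ≡ d) × (∀ v → d ≤ deg G v)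

IsMaxDeg : ∀ {n} → Graph n → ℕ → Set
IsMaxDeg {n} G d = (∃ λ (v : Fin n) → deg G v ≡ d) × (∀ v → deg G v ≤ d)

IsProper : ∀ {n k} → Graph n → (Fin n → Fin k) → Set
IsProper G c = ∀ u v → Adj G u v → c u ≢ c v

IsDynamic : ∀ {n k} → Graph n → (Fin n → Fin k) → Set
IsDynamic {n} G c = IsProper G c ×
  (∀ v → 2 ≤ deg G v →
     Σ (Fin n) λ u → Σ (Fin n) λ w → Adj G v u × Adj G v w × c u ≢ c w)

Colorable : ∀ {n} → Graph n → ℕ → Set
Colorable {n} G k = Σ (Fin n → Fin k) λ c → IsProper G c

DynColorable : ∀ {n} → Graph n → ℕ → Set
DynColorable {n} G k = Σ (Fin n → Fin k) λ c → IsDynamic G c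

IsChromaticNumber : ∀ {n} → Graph n → ℕ → Set
IsChromaticNumber G k = Colorable G k × (∀ j → Colorable G j → k ≤ j)

IsDynamicChromaticNumber : ∀ {n} → Graph n → ℕ → Set
IsDynamicChromaticNumber G k = DynColorable G k × (∀ j → DynColorable G j → k ≤ j)

-- ceiling division ⌈ m / d ⌉ = ⌊ (m + d - 1) / d ⌋ for d ≠ 0
-- (the value for d = 0 is an arbitrary convention, never used: δ = b ≥ 2)
⌈_/_⌉ : (m d : ℕ) → ℕ
⌈ m / zero ⌉ = 0
⌈ m / suc d ⌉ = (m + d) / suc d

module Submission where

-- Put k = ⌈(a + 1)/b⌉ and c = a + 1; then k ≥ 2 and
-- (k − 1)·b < c.  Take the complete k-partite graph with parts Y₁,…,Y_k of
-- size b, join a new vertex X_j to every vertex of Y_j, and add a disjoint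
-- complete bipartite graph with sides L (size b) and R (size c).  The X_j and
-- the R-vertices have degree b, the L-vertices degree c and the Y-vertices
-- degree (k − 1)·b + 1 ≤ c, so δ = b and Δ = c.
--
-- Colouring Y_j with colour j (and X_j, L, R suitably) shows χ ≤ k, and one
-- vertex from each part gives a k-clique, so χ = k.  Refining that colouring
-- by a Boolean "side" label gives a dynamic 2k-colouring.  Conversely, in a
-- dynamic colouring the neighbourhood Y_j of X_j carries two colours, and
-- vertices of different parts are adjacent, so the 2k chosen vertices get
-- pairwise distinct colours: χ₂ = 2k = χ + k.

open import Defs hiding (sym)
open import Data.Nat using (ℕ; zero; suc; _+_; _*_; _∸_; _≤_; _<_; z≤n; s≤s)
open import Data.Nat.Properties
  using (+-assoc; +-comm; +-suc; +-identityʳ; *-zeroʳ; *-identityʳ; +-commutativeSemigroup;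
         m≤m+n; m≤n⇒m≤1+n; <⇒≤; ≤-refl; ≤-trans; +-cancelˡ-≤; +-monoˡ-≤;
         m+[n∸m]≡n; module ≤-Reasoning)
open import Data.Nat.DivMod using (_/_; m/n*n≤m; m*n/n≡m; /-monoˡ-≤)
open import Algebra.Properties.CommutativeSemigroup +-commutativeSemigroup
  using (x∙yz≈y∙xz)
open import Data.Bool using (Bool; true; false; not; T; if_then_else_)
open import Data.Bool.Properties using (T?)
open import Data.Fin using (Fin; zero; suc; _↑ˡ_; _↑ʳ_; splitAt; join; combine; remQuot; _≟_)
open import Data.Fin.Properties
  using (splitAt-↑ˡ; splitAt-↑ʳ; join-splitAt; remQuot-combine;
         ↑ˡ-injective; ↑ʳ-injective; injective⇒≤)
open import Data.List using (length; filter)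
open import Data.List.Base using (tabulate)
open import Data.Product using (Σ; _×_; _,_; proj₁; proj₂; uncurry)
open import Data.Sum using (_⊎_; inj₁; inj₂; [_,_]′)
open import Data.Unit using (tt)
open import Function using (_∘_; id; mk⇔)
open import Relation.Binary.PropositionalEquality
open import Relation.Nullary using (does; yes; no)
open import Relation.Nullary.Decidable using (dec-true; dec-false; does-⇔; decidable-stable)

∑ : ∀ n → (Fin n → ℕ) → ℕ
∑ zero    f = 0
∑ (suc n) f = f zero + ∑ n (f ∘ suc)

∑-cong : ∀ n {f g : Fin n → ℕ} → (∀ i → f i ≡ g i) → ∑ n f ≡ ∑ n g
∑-cong zero    f≗g = refl
∑-cong (suc n) f≗g = cong₂ _+_ (f≗g zero) (∑-cong n (f≗g ∘ suc))

∑-const : ∀ n x → ∑ n (λ _ → x) ≡ n * x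
∑-const zero    x = refl
∑-const (suc n) x = cong (x +_) (∑-const n x)

∑-+ : ∀ m n (f : Fin (m + n) → ℕ) →
      ∑ (m + n) f ≡ ∑ m (f ∘ (_↑ˡ n)) + ∑ n (f ∘ (m ↑ʳ_))
∑-+ zero    n f = refl
∑-+ (suc m) n f = trans (cong (f zero +_) (∑-+ m n (f ∘ suc))) (sym (+-assoc (f zero) _ _))

∑-* : ∀ m n (f : Fin (m * n) → ℕ) →
      ∑ (m * n) f ≡ ∑ m (λ i → ∑ n (λ j → f (combine i j)))
∑-* zero    n f = refl
∑-* (suc m) n f = trans (∑-+ n (m * n) f) (cong (∑ n (f ∘ (_↑ˡ m * n)) +_) (∑-* m n (f ∘ (n ↑ʳ_))))

∑-none : ∀ n → ∑ n (λ _ → 0) ≡ 0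
∑-none n = trans (∑-const n 0) (*-zeroʳ n)

∑-all : ∀ n → ∑ n (λ _ → 1) ≡ n
∑-all n = trans (∑-const n 1) (*-identityʳ n)

ι : Bool → ℕ
ι b = if b then 1 else 0

count : ∀ n → (Fin n → Bool) → ℕ
count n p = ∑ n (ι ∘ p)

length-filter-tabulate : ∀ {m} n (f : Fin n → Fin m) (p : Fin m → Bool) →
  length (filter (λ u → T? (p u)) (tabulate f)) ≡ count n (p ∘ f)
length-filter-tabulate zero    f p = refl
length-filter-tabulate (suc n) f p with p (f zero)
... | true  = cong suc (length-filter-tabulate n (f ∘ suc) p)
... | false = length-filter-tabulate n (f ∘ suc) p

_≡ᵇ_ : ∀ {n} → Fin n → Fin n → Bool
i ≡ᵇ j = does (i ≟ j)

≡ᵇ-sound : ∀ {n} (i j : Fin n) → T (i ≡ᵇ j) → i ≡ j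
≡ᵇ-sound i j t with i ≟ j
... | yes i≡j = i≡j

≡ᵇ-refl : ∀ {n} (i : Fin n) → T (i ≡ᵇ i)
≡ᵇ-refl i rewrite dec-true (i ≟ i) refl = tt

≡ᵇ-sym : ∀ {n} (i j : Fin n) → i ≡ᵇ j ≡ j ≡ᵇ i
≡ᵇ-sym i j = does-⇔ (mk⇔ sym sym) (i ≟ j) (j ≟ i)

≢⇒T-not : ∀ {n} {i j : Fin n} → i ≢ j → T (not (i ≡ᵇ j))
≢⇒T-not {i = i} {j} i≢j rewrite dec-false (i ≟ j) i≢j = tt

T-not⇒≢ : ∀ {n} {i j : Fin n} → T (not (i ≡ᵇ j)) → i ≢ j
T-not⇒≢ {i = i} t refl rewrite dec-true (i ≟ i) refl = t

∑-point : ∀ {m} (j : Fin (suc m)) (f : Bool → ℕ) →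
          ∑ (suc m) (λ j′ → f (j ≡ᵇ j′)) ≡ f true + m * f false
∑-point {m}     zero    f = cong (f true +_) (∑-const m (f false))
∑-point {suc m} (suc j) f = trans (cong (f false +_) (∑-point j f))
                                  (x∙yz≈y∙xz (f false) (f true) (m * f false))

distinct⇒≤ : ∀ {n m} (f : Fin n → Fin m) → (∀ i j → i ≢ j → f i ≢ f j) → n ≤ m
distinct⇒≤ f distinct = injective⇒≤ λ {i} {j} fi≡fj →
  decidable-stable (i ≟ j) (λ i≢j → distinct i j i≢j fi≡fj)

distinct⊎⇒≤ : ∀ {m n r} (f : Fin m ⊎ Fin n → Fin r) →
              (∀ s t → s ≢ t → f s ≢ f t) → m + n ≤ r
distinct⊎⇒≤ {m} {n} f distinct = distinct⇒≤ (f ∘ splitAt m) λ i j i≢j →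
  distinct _ _ λ eq → i≢j (trans (sym (join-splitAt m n i))
                             (trans (cong (join m n) eq) (join-splitAt m n j)))

tag : ∀ {k} → Bool → Fin k → Fin (k + k)
tag {k} false i = i ↑ˡ k
tag {k} true  i = k ↑ʳ i

tag-injective : ∀ {k} s t (i j : Fin k) → tag s i ≡ tag t j → s ≡ t × i ≡ j
tag-injective {k} false false i j eq = refl , ↑ˡ-injective k i j eq
tag-injective {k} true  true  i j eq = refl , ↑ʳ-injective k i j eq
tag-injective {k} false true  i j eq
  with trans (sym (splitAt-↑ˡ k i k)) (trans (cong (splitAt k) eq) (splitAt-↑ʳ k k j))
... | ()
tag-injective {k} true  false i j eq
  with trans (sym (splitAt-↑ʳ k k i)) (trans (cong (splitAt k) eq) (splitAt-↑ˡ k j k))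
... | ()

⌈/⌉*≤ : ∀ m d → ⌈ m / suc d ⌉ * suc d ≤ m + d
⌈/⌉*≤ m d = m/n*n≤m (m + d) (suc d)

2≤⌈/⌉ : ∀ m d → suc d < m → 2 ≤ ⌈ m / suc d ⌉
2≤⌈/⌉ m d d<m = begin
  2                         ≡⟨ m*n/n≡m 2 (suc d) ⟨
  2 * suc d / suc d         ≤⟨ /-monoˡ-≤ (suc d) 2d+2≤m+d ⟩
  (m + d) / suc d           ∎
  where
  open ≤-Reasoning
  2d+2≤m+d : 2 * suc d ≤ m + d
  2d+2≤m+d = begin
    2 * suc d                 ≡⟨ cong suc (trans (+-suc d (d + 0)) (cong suc (cong (d +_) (+-identityʳ d)))) ⟩
    suc (suc (d + d))         ≡⟨⟩
    suc (suc d) + d           ≤⟨ +-monoˡ-≤ d d<m ⟩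
    m + d                     ∎

⌈/⌉-bounds : ∀ m d → suc d < m →
  Σ ℕ λ k′ → ⌈ m / suc d ⌉ ≡ suc (suc k′) × suc k′ * suc d < m
⌈/⌉-bounds m d d<m = k′ , k≡ , +-cancelˡ-≤ d _ _ bound
  where
  open ≤-Reasoning
  k′ : ℕ
  k′ = ⌈ m / suc d ⌉ ∸ 2
  k≡ : ⌈ m / suc d ⌉ ≡ suc (suc k′)
  k≡ = sym (m+[n∸m]≡n (2≤⌈/⌉ m d d<m))
  bound : d + suc (suc k′ * suc d) ≤ d + m
  bound = begin
    d + suc (suc k′ * suc d)  ≡⟨ +-suc d _ ⟩
    suc (d + suc k′ * suc d)  ≡⟨⟩
    suc (suc k′) * suc d      ≡⟨ cong (_* suc d) k≡ ⟨
    ⌈ m / suc d ⌉ * suc d     ≤⟨ ⌈/⌉*≤ m d ⟩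
    m + d                     ≡⟨ +-comm m d ⟩
    d + m                     ∎

module Presented {V : Set} (A : V → V → Bool)
                 (A-sym : ∀ u v → A u v ≡ A v u) (A-irr : ∀ v → A v v ≡ false)
                 {N : ℕ} (dec : Fin N → V) (enc : V → Fin N)
                 (dec-enc : ∀ v → dec (enc v) ≡ v) where

  G : Graph N
  G = record { adj      = λ x y → A (dec x) (dec y)
             ; sym      = λ x y → A-sym (dec x) (dec y)
             ; loopless = λ x → A-irr (dec x) }

  adjʳ : ∀ x {v} → T (A (dec x) v) → Adj G x (enc v)
  adjʳ x {v} = subst (T ∘ A (dec x)) (sym (dec-enc v))

  adj-enc : ∀ u v → T (A u v) → Adj G (enc u) (enc v)
  adj-enc u v t = adjʳ (enc u) (subst (λ w → T (A w v)) (sym (dec-enc u)) t)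

  adj-from-enc : ∀ v y → Adj G (enc v) y → T (A v (dec y))
  adj-from-enc v y = subst (λ w → T (A w (dec y))) (dec-enc v)

  deg-count : ∀ x → deg G x ≡ count N (λ y → A (dec x) (dec y))
  deg-count x = length-filter-tabulate N id (λ y → A (dec x) (dec y))

  ProperOn : ∀ {m} → (V → Fin m) → Set
  ProperOn col = ∀ u v → T (A u v) → col u ≢ col v

  colourable : ∀ {m} (col : V → Fin m) → ProperOn col → Colorable G m
  colourable col proper = col ∘ dec , λ x y → proper (dec x) (dec y)

  SeesBoth : (V → Bool) → Set
  SeesBoth side = ∀ v → Σ V λ u → Σ V λ w → T (A v u) × T (A v w) × side u ≢ side w

  refine-dynamic : ∀ {m} (col : V → Fin m) (side : V → Bool) →
                   ProperOn col → SeesBoth side → DynColorable G (m + m)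
  refine-dynamic {m} col side proper sees = dcol ∘ dec , dproper , dyn
    where
    dcol : V → Fin (m + m)
    dcol v = tag (side v) (col v)

    dproper : IsProper G (dcol ∘ dec)
    dproper x y xy eq =
      proper (dec x) (dec y) xy (proj₂ (tag-injective (side (dec x)) (side (dec y)) _ _ eq))

    dyn : ∀ x → 2 ≤ deg G x → Σ (Fin N) λ y → Σ (Fin N) λ z →
          Adj G x y × Adj G x z × dcol (dec y) ≢ dcol (dec z)
    dyn x _ with sees (dec x)
    ... | u , w , xu , xw , su≢sw =
      enc u , enc w , adjʳ x xu , adjʳ x xw ,
      subst₂ (λ p q → dcol p ≢ dcol q) (sym (dec-enc u)) (sym (dec-enc w))
             (su≢sw ∘ proj₁ ∘ tag-injective (side u) (side w) (col u) (col w))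

-- The sizes are at least 2 because the colouring arguments pick
-- two distinct vertices in each of these sets.
module Construction (k′ b′ c′ : ℕ) where

  k b c : ℕ
  k = suc (suc k′)
  b = suc (suc b′)
  c = suc (suc c′)

  data V : Set where
    Y : Fin k → Fin b → V
    X : Fin k → V
    L : Fin b → V
    R : Fin c → V

  A : V → V → Bool
  A (Y j _) (Y j′ _) = not (j ≡ᵇ j′)
  A (Y j _) (X j′)   = j ≡ᵇ j′
  A (X j)   (Y j′ _) = j ≡ᵇ j′
  A (L _)   (R _)    = true
  A (R _)   (L _)    = true
  A _       _        = false

  A-sym : ∀ u v → A u v ≡ A v u
  A-sym (Y j _) (Y j′ _) = cong not (≡ᵇ-sym j j′)
  A-sym (Y j _) (X j′)   = ≡ᵇ-sym j j′
  A-sym (X j)   (Y j′ _) = ≡ᵇ-sym j j′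
  A-sym (Y _ _) (L _)    = refl
  A-sym (Y _ _) (R _)    = refl
  A-sym (X _)   (X _)    = refl
  A-sym (X _)   (L _)    = refl
  A-sym (X _)   (R _)    = refl
  A-sym (L _)   (Y _ _)  = refl
  A-sym (L _)   (X _)    = refl
  A-sym (L _)   (L _)    = refl
  A-sym (L _)   (R _)    = refl
  A-sym (R _)   (Y _ _)  = refl
  A-sym (R _)   (X _)    = refl
  A-sym (R _)   (L _)    = refl
  A-sym (R _)   (R _)    = refl

  A-irr : ∀ v → A v v ≡ false
  A-irr (Y j _) rewrite dec-true (j ≟ j) refl = refl
  A-irr (X _)   = refl
  A-irr (L _)   = refl
  A-irr (R _)   = refl

  data Edge : V → V → Set where
    Y-Y : ∀ {j j′ r r′} → j ≢ j′ → Edge (Y j r) (Y j′ r′)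
    Y-X : ∀ {j r} → Edge (Y j r) (X j)
    X-Y : ∀ {j r} → Edge (X j) (Y j r)
    L-R : ∀ {l r} → Edge (L l) (R r)
    R-L : ∀ {l r} → Edge (R r) (L l)

  edge : ∀ u v → T (A u v) → Edge u v
  edge (Y j _) (Y j′ _) t = Y-Y (T-not⇒≢ t)
  edge (Y j _) (X j′)   t rewrite ≡ᵇ-sound j j′ t = Y-X
  edge (X j)   (Y j′ _) t rewrite ≡ᵇ-sound j j′ t = X-Y
  edge (L _)   (R _)    t = L-R
  edge (R _)   (L _)    t = R-L
  edge (Y _ _) (L _)    ()
  edge (Y _ _) (R _)    ()
  edge (X _)   (X _)    ()
  edge (X _)   (L _)    ()
  edge (X _)   (R _)    ()
  edge (L _)   (Y _ _)  ()
  edge (L _)   (X _)    ()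
  edge (L _)   (L _)    ()
  edge (R _)   (Y _ _)  ()
  edge (R _)   (X _)    ()
  edge (R _)   (R _)    ()

  adjacent : ∀ u v → Edge u v → T (A u v)
  adjacent _ _ (Y-Y j≢j′) = ≢⇒T-not j≢j′
  adjacent _ _ (Y-X {j})  = ≡ᵇ-refl j
  adjacent _ _ (X-Y {j})  = ≡ᵇ-refl j
  adjacent _ _ L-R        = tt
  adjacent _ _ R-L        = tt

  N : ℕ
  N = k * b + (k + (b + c))

  enc : V → Fin N
  enc (Y j r) = combine j r ↑ˡ (k + (b + c))
  enc (X j)   = (k * b) ↑ʳ (j ↑ˡ (b + c))
  enc (L l)   = (k * b) ↑ʳ (k ↑ʳ (l ↑ˡ c))
  enc (R r)   = (k * b) ↑ʳ (k ↑ʳ (b ↑ʳ r))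

  dec : Fin N → V
  dec = [ uncurry Y ∘ remQuot b
        , [ X , [ L , R ]′ ∘ splitAt b ]′ ∘ splitAt k ]′ ∘ splitAt (k * b)

  dec-enc : ∀ v → dec (enc v) ≡ v
  dec-enc (Y j r) rewrite splitAt-↑ˡ (k * b) (combine j r) (k + (b + c)) =
    cong (uncurry Y) (remQuot-combine j r)
  dec-enc (X j) rewrite splitAt-↑ʳ (k * b) (k + (b + c)) (j ↑ˡ (b + c))
                      | splitAt-↑ˡ k j (b + c) = refl
  dec-enc (L l) rewrite splitAt-↑ʳ (k * b) (k + (b + c)) (k ↑ʳ (l ↑ˡ c))
                      | splitAt-↑ʳ k (b + c) (l ↑ˡ c)
                      | splitAt-↑ˡ b l c = refl
  dec-enc (R r) rewrite splitAt-↑ʳ (k * b) (k + (b + c)) (k ↑ʳ (b ↑ʳ r))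
                      | splitAt-↑ʳ k (b + c) (b ↑ʳ r)
                      | splitAt-↑ʳ b c r = refl

  open Presented A A-sym A-irr dec enc dec-enc public

  open ≡-Reasoning

  ∑V : (V → ℕ) → ℕ
  ∑V h = ∑ k (λ j → ∑ b (h ∘ Y j)) + (∑ k (h ∘ X) + (∑ b (h ∘ L) + ∑ c (h ∘ R)))

  ∑-enc : ∀ g → ∑ N g ≡ ∑V (g ∘ enc)
  ∑-enc g = trans (∑-+ (k * b) (k + (b + c)) g)
    (cong₂ _+_ (∑-* k b (g ∘ (_↑ˡ (k + (b + c)))))
               (trans (∑-+ k (b + c) tail)
                      (cong (∑ k (g ∘ enc ∘ X) +_) (∑-+ b c (tail ∘ (k ↑ʳ_))))))
    where
    tail : Fin (k + (b + c)) → ℕ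
    tail = g ∘ ((k * b) ↑ʳ_)

  ∑V-cong : ∀ {g h : V → ℕ} → (∀ v → g v ≡ h v) → ∑V g ≡ ∑V h
  ∑V-cong g≗h = cong₂ _+_ (∑-cong k λ j → ∑-cong b (g≗h ∘ Y j))
    (cong₂ _+_ (∑-cong k (g≗h ∘ X)) (cong₂ _+_ (∑-cong b (g≗h ∘ L)) (∑-cong c (g≗h ∘ R))))

  degree : V → ℕ
  degree (Y _ _) = suc (suc k′ * b)
  degree (X _)   = b
  degree (L _)   = c
  degree (R _)   = b

  neighbours : ∀ v → ∑V (ι ∘ A v) ≡ degree v
  neighbours (Y j _) = begin
    ∑ k (λ j′ → ∑ b (λ _ → ι (not (j ≡ᵇ j′)))) + (∑ k (λ j′ → ι (j ≡ᵇ j′)) + (∑ b (λ _ → 0) + ∑ c (λ _ → 0)))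
      ≡⟨ cong₂ _+_ (∑-point j (λ s → ∑ b (λ _ → ι (not s))))
                   (cong₂ _+_ (∑-point j ι) (cong₂ _+_ (∑-none b) (∑-none c))) ⟩
    (∑ b (λ _ → 0) + suc k′ * ∑ b (λ _ → 1)) + ((1 + suc k′ * 0) + 0)
      ≡⟨ cong₂ _+_ (cong₂ _+_ (∑-none b) (cong (suc k′ *_) (∑-all b)))
                   (cong suc (trans (+-identityʳ _) (*-zeroʳ (suc k′)))) ⟩
    suc k′ * b + 1
      ≡⟨ +-comm (suc k′ * b) 1 ⟩
    suc (suc k′ * b) ∎
  neighbours (X j) = begin
    ∑ k (λ j′ → ∑ b (λ _ → ι (j ≡ᵇ j′))) + (∑ k (λ _ → 0) + (∑ b (λ _ → 0) + ∑ c (λ _ → 0)))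
      ≡⟨ cong₂ _+_ (∑-point j (λ s → ∑ b (λ _ → ι s)))
                   (cong₂ _+_ (∑-none k) (cong₂ _+_ (∑-none b) (∑-none c))) ⟩
    (∑ b (λ _ → 1) + suc k′ * ∑ b (λ _ → 0)) + 0
      ≡⟨ +-identityʳ _ ⟩
    ∑ b (λ _ → 1) + suc k′ * ∑ b (λ _ → 0)
      ≡⟨ cong₂ _+_ (∑-all b) (trans (cong (suc k′ *_) (∑-none b)) (*-zeroʳ (suc k′))) ⟩
    b + 0
      ≡⟨ +-identityʳ b ⟩
    b ∎
  neighbours (L _) = cong₂ _+_ (trans (∑-cong k (λ _ → ∑-none b)) (∑-none k))
    (cong₂ _+_ (∑-none k) (cong₂ _+_ (∑-none b) (∑-all c)))
  neighbours (R _) = trans (cong₂ _+_ (trans (∑-cong k (λ _ → ∑-none b)) (∑-none k))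
    (cong₂ _+_ (∑-none k) (cong₂ _+_ (∑-all b) (∑-none c)))) (+-identityʳ b)

  deg-dec : ∀ x → deg G x ≡ degree (dec x)
  deg-dec x = begin
    deg G x                                     ≡⟨ deg-count x ⟩
    count N (λ y → A (dec x) (dec y))           ≡⟨ ∑-enc (λ y → ι (A (dec x) (dec y))) ⟩
    ∑V (λ v → ι (A (dec x) (dec (enc v))))      ≡⟨ ∑V-cong (λ v → cong (ι ∘ A (dec x)) (dec-enc v)) ⟩
    ∑V (ι ∘ A (dec x))                          ≡⟨ neighbours (dec x) ⟩
    degree (dec x)                              ∎

  deg-enc : ∀ v → deg G (enc v) ≡ degree v
  deg-enc v = trans (deg-dec (enc v)) (cong degree (dec-enc v))

  b≤c : suc k′ * b < c → b ≤ c
  b≤c fits = ≤-trans (m≤m+n b (k′ * b)) (<⇒≤ fits)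

  δ-is-b : suc k′ * b < c → IsMinDeg G b
  δ-is-b fits = (enc (X zero) , deg-enc (X zero)) ,
                λ x → subst (b ≤_) (sym (deg-dec x)) (at-least (dec x))
    where
    at-least : ∀ v → b ≤ degree v
    at-least (Y _ _) = m≤n⇒m≤1+n (m≤m+n b (k′ * b))
    at-least (X _)   = ≤-refl
    at-least (L _)   = b≤c fits
    at-least (R _)   = ≤-refl

  Δ-is-c : suc k′ * b < c → IsMaxDeg G c
  Δ-is-c fits = (enc (L zero) , deg-enc (L zero)) ,
                λ x → subst (_≤ c) (sym (deg-dec x)) (at-most (dec x))
    where
    at-most : ∀ v → degree v ≤ c
    at-most (Y _ _) = fits
    at-most (X _)   = b≤c fits
    at-most (L _)   = ≤-refl
    at-most (R _)   = b≤c fits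

  other : Fin k → Fin k
  other zero    = suc zero
  other (suc _) = zero

  other-≢ : ∀ j → other j ≢ j
  other-≢ zero    ()
  other-≢ (suc _) ()

  col : V → Fin k
  col (Y j _) = j
  col (X j)   = other j
  col (L _)   = zero
  col (R _)   = suc zero

  col-proper : ProperOn col
  col-proper u v t = along (edge u v t)
    where
    along : ∀ {u v} → Edge u v → col u ≢ col v
    along (Y-Y j≢j′) = j≢j′
    along (Y-X {j})  = other-≢ j ∘ sym
    along (X-Y {j})  = other-≢ j
    along L-R        = λ ()
    along R-L        = λ ()

  later : ∀ {n} → Fin n → Bool
  later zero    = false
  later (suc _) = true

  side : V → Bool
  side (Y _ r) = later r
  side (X _)   = false
  side (L l)   = later l
  side (R r)   = later r

  sees-both-sides : SeesBoth side
  sees-both-sides (Y j r) = Y (other j) zero , Y (other j) (suc zero) ,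
    adjacent (Y j r) (Y (other j) zero) (Y-Y (other-≢ j ∘ sym)) ,
    adjacent (Y j r) (Y (other j) (suc zero)) (Y-Y (other-≢ j ∘ sym)) , λ ()
  sees-both-sides (X j) = Y j zero , Y j (suc zero) ,
    adjacent (X j) (Y j zero) X-Y , adjacent (X j) (Y j (suc zero)) X-Y , λ ()
  sees-both-sides (L _) = R zero , R (suc zero) , tt , tt , λ ()
  sees-both-sides (R _) = L zero , L (suc zero) , tt , tt , λ ()

  -- One vertex from each part forms a k-clique, so χ ≥ k.
  χ-lower : ∀ m → Colorable G m → k ≤ m
  χ-lower m (κ , proper) = distinct⇒≤ (λ j → κ (enc (Y j zero)))
    λ i j i≢j → proper _ _ (adj-enc (Y i zero) (Y j zero) (adjacent (Y i zero) (Y j zero) (Y-Y i≢j)))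

  χ-is-k : IsChromaticNumber G k
  χ-is-k = colourable col col-proper , χ-lower

  InPart : Fin k → Fin N → Set
  InPart j x = Σ (Fin b) λ r → dec x ≡ Y j r

  cross-adj : ∀ {i j} x y → i ≢ j → InPart i x → InPart j y → Adj G x y
  cross-adj {i} {j} _ _ i≢j (r , x∈) (r′ , y∈) =
    subst₂ (λ p q → T (A p q)) (sym x∈) (sym y∈) (adjacent (Y i r) (Y j r′) (Y-Y i≢j))

  X-neighbour : ∀ j x → Adj G (enc (X j)) x → InPart j x
  X-neighbour j x t with dec x | edge (X j) (dec x) (adj-from-enc (X j) x t)
  ... | .(Y j r) | X-Y {r = r} = r , refl

  record Bicoloured {m} (κ : Fin N → Fin m) (j : Fin k) : Set where
    field
      fst snd   : Fin N
      fst∈      : InPart j fst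
      snd∈      : InPart j snd
      different : κ fst ≢ κ snd

  -- If every part is bicoloured by a proper colouring, it uses ≥ 2k colours:
  -- the 2k chosen vertices are pairwise differently coloured.
  bicoloured⇒≥ : ∀ {m} (κ : Fin N → Fin m) → IsProper G κ →
                 (∀ j → Bicoloured κ j) → k + k ≤ m
  bicoloured⇒≥ κ proper two = distinct⊎⇒≤ (κ ∘ vertex) distinct
    where
    open Bicoloured
    part : Fin k ⊎ Fin k → Fin k
    part = [ id , id ]′

    vertex : Fin k ⊎ Fin k → Fin N
    vertex (inj₁ j) = fst (two j)
    vertex (inj₂ j) = snd (two j)

    in-part : ∀ s → InPart (part s) (vertex s)
    in-part (inj₁ j) = fst∈ (two j)
    in-part (inj₂ j) = snd∈ (two j)

    apart : ∀ s t → part s ≢ part t → κ (vertex s) ≢ κ (vertex t)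
    apart s t ne = proper _ _ (cross-adj (vertex s) (vertex t) ne (in-part s) (in-part t))

    distinct : ∀ s t → s ≢ t → κ (vertex s) ≢ κ (vertex t)
    distinct (inj₁ i) (inj₁ j) s≢t = apart (inj₁ i) (inj₁ j) (s≢t ∘ cong inj₁)
    distinct (inj₂ i) (inj₂ j) s≢t = apart (inj₂ i) (inj₂ j) (s≢t ∘ cong inj₂)
    distinct (inj₁ i) (inj₂ j) _ with i ≟ j
    ... | yes refl = different (two i)
    ... | no  i≢j  = apart (inj₁ i) (inj₂ j) i≢j
    distinct (inj₂ i) (inj₁ j) _ with i ≟ j
    ... | yes refl = different (two i) ∘ sym
    ... | no  i≢j  = apart (inj₂ i) (inj₁ j) i≢j

  -- A dynamic colouring bicolours every part, namely the neighbourhood of X_j.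
  dynamic⇒bicoloured : ∀ {m} (κ : Fin N → Fin m) → IsDynamic G κ → ∀ j → Bicoloured κ j
  dynamic⇒bicoloured κ (_ , dyn) j
    with dyn (enc (X j)) (subst (2 ≤_) (sym (deg-enc (X j))) (s≤s (s≤s z≤n)))
  ... | u , w , ju , jw , κu≢κw = record
    { fst = u ; snd = w
    ; fst∈ = X-neighbour j u ju ; snd∈ = X-neighbour j w jw
    ; different = κu≢κw }

  χ₂-is-2k : IsDynamicChromaticNumber G (k + k)
  χ₂-is-2k = refine-dynamic col side col-proper sees-both-sides ,
             λ { m (κ , dynamic) → bicoloured⇒≥ κ (proj₁ dynamic) (dynamic⇒bicoloured κ dynamic) }

proposition2 : (a b : ℕ) → 2 ≤ b → b ≤ a →
    Σ ℕ λ n → Σ (Graph n) λ G →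
    IsMinDeg G b × IsMaxDeg G (suc a) ×
    Σ ℕ λ χ → Σ ℕ λ χ₂ →
    IsChromaticNumber G χ × IsDynamicChromaticNumber G χ₂ ×
    χ₂ ≡ χ + ⌈ suc a / b ⌉
proposition2 _        zero           ()                _
proposition2 _        (suc zero)     (s≤s ())          _
proposition2 zero     (suc (suc b′)) _                 ()
proposition2 (suc a′) (suc (suc b′)) _                 b≤a
  with ⌈/⌉-bounds (suc (suc a′)) (suc b′) (s≤s b≤a)
... | k′ , ⌈⌉≡k , fits =
  N , G , δ-is-b fits , Δ-is-c fits , k , k + k , χ-is-k , χ₂-is-2k ,
  cong (k +_) (sym ⌈⌉≡k)
  where open Construction k′ b′ a′   -- k = 2 + k′, b = 2 + b′, c = 2 + a′ = a + 1
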